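{- Let $k$ be a positive integer. (1) There is no function $f:\mathbb{N}\to\mathbb{N}$ such that $\gamma_{P,k}(G-v)\le f(\gamma_{P,k}(G))$ for every graph $G$ and every vertex $v$ of $G$. (2) For every graph $G$ and every vertex $v$ of $G$, $\gamma_{P,k}(G-v)\ge \gamma_{P,k}(G)-1$. (3) Moreover, if $\gamma_{P,k}(G-v)=\gamma_{P,k}(G)-1$, then $\mathrm{rad}_{P,k}(G)\le \mathrm{rad}_{P,k}(G-v)$.
   Context: All graphs are finite and simple. $N_G[v]$ is the closed neighbourhood of $v$ and $N_G[S]=\bigcup_{v\in S}N_G[v]$. $G-v$ is obtained from $G$ by deleting $v$ and its incident edges. For $S\subseteq V(G)$, define $\mathcal{P}^{0}_{G,k}(S)=N_G[S]$ and $\mathcal{P}^{t+1}_{G,k}(S)=\bigcup\{N_G[u] : u\in \mathcal{P}^{t}_{G,k}(S),\ |N_G[u]\setminus \mathcal{P}^{t}_{G,k}(S)|\le k\}$; these sets increase and stabilize to $\mathcal{P}^{\infty}_{G,k}(S)$. $S$ is a $k$-power dominating set ($k$-PDS) if $\mathcal{P}^{\infty}_{G,k}(S)=V(G)$; $\gamma_{P,k}(G)$ is the minimum size of a $k$-PDS. For a $k$-PDS $S$, $\mathrm{rad}_{P,k}(G,S)=1+\min\{t:\mathcal{P}^{t}_{G,k}(S)=V(G)\}$, and $\mathrm{rad}_{P,k}(G)$ is the minimum of $\mathrm{rad}_{P,k}(G,S)$ over all $k$-PDS $S$ of size $\gamma_{P,k}(G)$. -}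

module Defs where

open import Data.Nat using (ℕ; zero; suc; _≤_; _≤?_)
open import Data.Bool using (Bool; true; false; _∧_; _∨_; if_then_else_)
open import Data.Fin using (Fin; punchIn)
import Data.Fin as Fin
open import Data.Fin.Subset using (Subset; _∈_; ⊥; _─_; ∣_∣; ⋃)
open import Data.Vec using (tabulate; lookup)
open import Data.List using (map; allFin)
open import Data.Product using (∃; ∃-syntax; _×_; Σ-syntax)
open import Relation.Nullary.Decidable using (⌊_⌋)
open import Relation.Binary.PropositionalEquality using (_≡_)

record Graph (n : ℕ) : Set where
  field
    adj    : Fin n → Fin n → Bool
    adj-sym     : ∀ u v → adj u v ≡ adj v u
    adj-irrefl  : ∀ v → adj v v ≡ false
open Graph public

-- G - v : delete vertex v; the remaining vertices are renumbered via punchIn v.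
delete : ∀ {n} → Graph (suc n) → Fin (suc n) → Graph n
delete G v = record
  { adj = λ i j → adj G (punchIn v i) (punchIn v j)
  ; adj-sym = λ i j → adj-sym G (punchIn v i) (punchIn v j)
  ; adj-irrefl = λ i → adj-irrefl G (punchIn v i)
  }

N[_]_ : ∀ {n} → Graph n → Fin n → Subset n
N[ G ] v = tabulate (λ w → ⌊ w Fin.≟ v ⌋ ∨ adj G v w)

NS[_]_ : ∀ {n} → Graph n → Subset n → Subset n
NS[ G ] S = ⋃ (map (λ u → if lookup S u then N[ G ] u else ⊥) (allFin _))

step : ∀ {n} → ℕ → Graph n → Subset n → Subset n
step k G X =
  ⋃ (map (λ u → if lookup X u ∧ ⌊ ∣ (N[ G ] u) ─ X ∣ ≤? k ⌋ then N[ G ] u else ⊥)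
         (allFin _))

P : ∀ {n} → ℕ → Graph n → ℕ → Subset n → Subset n
P k G zero    S = NS[ G ] S
P k G (suc t) S = step k G (P k G t S)

Full : ∀ {n} → Subset n → Set
Full {n} X = ∀ (w : Fin n) → w ∈ X

IsPDS : ∀ {n} → ℕ → Graph n → Subset n → Set
IsPDS k G S = ∀ w → ∃[ t ] (w ∈ P k G t S)

IsGammaP : ∀ {n} → ℕ → Graph n → ℕ → Set
IsGammaP {n} k G m =
  (∃[ S ] (IsPDS k G S × ∣ S ∣ ≡ m)) × (∀ (S : Subset n) → IsPDS k G S → m ≤ ∣ S ∣)

IsRadPS : ∀ {n} → ℕ → Graph n → Subset n → ℕ → Set
IsRadPS k G S r =
  ∃[ t ] (r ≡ suc t × Full (P k G t S) × (∀ t' → Full (P k G t' S) → t ≤ t'))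

IsRadP : ∀ {n} → ℕ → Graph n → ℕ → ℕ → Set
IsRadP {n} k G γ r =
  (∃[ S ] (IsPDS k G S × ∣ S ∣ ≡ γ × IsRadPS k G S r))
  × (∀ (S : Subset n) → IsPDS k G S → ∣ S ∣ ≡ γ → ∀ r' → IsRadPS k G S r' → r ≤ r')

-- Deleting the centre of the star K_{1,m} (γ = 1) leaves m isolated vertices
-- (γ = m), so γ(G - v) is not bounded in terms of γ(G).
-- Conversely, if S is a k-PDS of G - v then S ∪ {v} is one of G: by induction
-- on t, v ∈ P^t_G(S ∪ {v}) ⊇ P^t_{G-v}(S), because v is observed from the start
-- and so every vertex of G - v has at most as many unobserved neighbours in G
-- as in G - v. Hence γ(G) ≤ γ(G - v) + 1, and when equality holds S ∪ {v} is a
-- minimum k-PDS of G observing everything no later than S does in G - v.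
module Submission where

open import Defs
open import Data.Bool using (Bool; true; false; T; if_then_else_)
open import Data.Bool.Properties using (T-∧; T-∨; T-≡)
open import Data.Empty using (⊥-elim)
open import Data.Fin using (Fin; zero; suc; punchIn; punchOut; _≟_)
open import Data.Fin.Properties using (punchIn-injective; punchIn-punchOut; all?)
open import Data.Fin.Subset
  using (Subset; _∈_; _∉_; _⊆_; ⊥; ⊤; _─_; ∣_∣; ⋃; ⁅_⁆; inside; outside;
         Nonempty; Empty)
open import Data.Fin.Subset.Properties
  using (_∈?_; ∉⊥; ∈⊤; ∣⊤∣≡n; ∣⊥∣≡0; x∈⁅x⁆; x∈⁅y⁆⇒x≡y; ∣⁅x⁆∣≡1; x∈p∪q⁻; x∈p∪q⁺;
         x∈p∧x∉q⇒x∈p─q; p─q⊆p; p⊆q⇒∣p∣≤∣q∣; Empty-unique)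
open import Data.List using (List; []; _∷_; map; allFin)
open import Data.List.Relation.Unary.Any using (Any; here; there; satisfied)
open import Data.List.Relation.Unary.Any.Properties using (map⁺; map⁻)
open import Data.List.Membership.Propositional using (lose)
open import Data.List.Membership.Propositional.Properties using (∈-allFin)
open import Data.Nat using (ℕ; zero; suc; _≤_; z≤n; s≤s)
open import Data.Nat.Properties
  using (≤-refl; ≤-trans; ≤-reflexive; ≤-pred; 1+n≰n; m≤n⇒m≤1+n; m≤n⇒m<n∨m≡n; ≰⇒>)
open import Data.Product using (Σ-syntax; ∃-syntax; _×_; _,_)
open import Data.Sum using (_⊎_; inj₁; inj₂; [_,_]′)
import Data.Sum as Sum
open import Data.Vec using (_∷_; here; there; lookup; insertAt)
open import Data.Vec.Properties
  using ([]=⇒lookup; lookup⇒[]=; lookup∘tabulate; insertAt-lookup; insertAt-punchIn)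
open import Function using (id; _∘_)
open import Function.Bundles using (Equivalence)
open import Relation.Nullary using (¬_; Dec; yes; no)
open import Relation.Nullary.Decidable using (toWitness; fromWitness)
open import Relation.Unary using (Decidable)
open import Relation.Binary.PropositionalEquality using (_≡_; refl; sym; trans; cong; subst)

private variable
  m n k t : ℕ

∈⇒T-lookup : {p : Subset n} {x : Fin n} → x ∈ p → T (lookup p x)
∈⇒T-lookup x∈p = Equivalence.from T-≡ ([]=⇒lookup x∈p)

T-lookup⇒∈ : {p : Subset n} {x : Fin n} → T (lookup p x) → x ∈ p
T-lookup⇒∈ {p = p} {x} t = lookup⇒[]= x p (Equivalence.to T-≡ t)

x∈p─q⇒x∉q : (p q : Subset n) {x : Fin n} → x ∈ p ─ q → x ∉ q
x∈p─q⇒x∉q (_ ∷ p) (outside ∷ q) here ()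
x∈p─q⇒x∉q (_ ∷ p) (inside ∷ q) () here
x∈p─q⇒x∉q (_ ∷ p) (_ ∷ q) (there x∈p─q) (there x∈q) = x∈p─q⇒x∉q p q x∈p─q x∈q

p⊆q⇒∣p─q∣≡0 : {p q : Subset n} → p ⊆ q → ∣ p ─ q ∣ ≡ 0
p⊆q⇒∣p─q∣≡0 {n} {p} {q} p⊆q = trans (cong ∣_∣ (Empty-unique p─q-empty)) (∣⊥∣≡0 n)
  where
  p─q-empty : Empty (p ─ q)
  p─q-empty (x , x∈p─q) = x∈p─q⇒x∉q p q x∈p─q (p⊆q (p─q⊆p p q x∈p─q))

Nonempty⇒1≤∣p∣ : {p : Subset n} → Nonempty p → 1 ≤ ∣ p ∣
Nonempty⇒1≤∣p∣ {p = p} (x , x∈p) =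
  subst (_≤ ∣ p ∣) (∣⁅x⁆∣≡1 x) (p⊆q⇒∣p∣≤∣q∣ ⁅x⁆⊆p)
  where
  ⁅x⁆⊆p : ⁅ x ⁆ ⊆ p
  ⁅x⁆⊆p y∈⁅x⁆ = subst (_∈ p) (sym (x∈⁅y⁆⇒x≡y x y∈⁅x⁆)) x∈p

x∈⋃⁻ : (ps : List (Subset n)) {x : Fin n} → x ∈ ⋃ ps → Any (x ∈_) ps
x∈⋃⁻ []       x∈⋃ = ⊥-elim (∉⊥ x∈⋃)
x∈⋃⁻ (p ∷ ps) x∈⋃ = [ here , there ∘ x∈⋃⁻ ps ]′ (x∈p∪q⁻ p (⋃ ps) x∈⋃)

x∈⋃⁺ : {ps : List (Subset n)} {x : Fin n} → Any (x ∈_) ps → x ∈ ⋃ ps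
x∈⋃⁺ (here x∈p)    = x∈p∪q⁺ (inj₁ x∈p)
x∈⋃⁺ (there x∈⋃ps) = x∈p∪q⁺ (inj₂ (x∈⋃⁺ x∈⋃ps))

-- Both NS[ G ] and step unfold to this shape.
⋃-when : (Fin m → Bool) → (Fin m → Subset n) → Subset n
⋃-when b A = ⋃ (map (λ u → if b u then A u else ⊥) (allFin _))

∈⋃-when⁻ : (b : Fin m → Bool) (A : Fin m → Subset n) {x : Fin n} →
  x ∈ ⋃-when b A → ∃[ u ] (T (b u) × x ∈ A u)
∈⋃-when⁻ b A x∈⋃ =
  let (u , x∈Au) = satisfied (map⁻ (x∈⋃⁻ (map (λ u → if b u then A u else ⊥) (allFin _)) x∈⋃))
  in u , guarded (b u) x∈Au
  where
  guarded : ∀ c {p : Subset _} {x} → x ∈ (if c then p else ⊥) → T c × x ∈ p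
  guarded true  x∈p = _ , x∈p
  guarded false x∈⊥ = ⊥-elim (∉⊥ x∈⊥)

∈⋃-when⁺ : (b : Fin m → Bool) (A : Fin m → Subset n) {u : Fin m} {x : Fin n} →
  T (b u) → x ∈ A u → x ∈ ⋃-when b A
∈⋃-when⁺ b A {u} {x} bu x∈Au = x∈⋃⁺ (map⁺ (lose (∈-allFin u) (guarded (b u) bu)))
  where
  guarded : ∀ c → T c → x ∈ (if c then A u else ⊥)
  guarded true _ = x∈Au

∣insertAt∣≡∣∷∣ : ∀ (p : Subset n) i {s} → ∣ insertAt p i s ∣ ≡ ∣ s ∷ p ∣
∣insertAt∣≡∣∷∣ p             zero    = refl
∣insertAt∣≡∣∷∣ (inside ∷ p)  (suc i) {inside}  = cong suc (∣insertAt∣≡∣∷∣ p i)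
∣insertAt∣≡∣∷∣ (inside ∷ p)  (suc i) {outside} = cong suc (∣insertAt∣≡∣∷∣ p i)
∣insertAt∣≡∣∷∣ (outside ∷ p) (suc i) {inside}  = ∣insertAt∣≡∣∷∣ p i
∣insertAt∣≡∣∷∣ (outside ∷ p) (suc i) {outside} = ∣insertAt∣≡∣∷∣ p i

data PunchInView (v : Fin (suc n)) : Fin (suc n) → Set where
  pivot   : PunchInView v v
  punched : ∀ i → PunchInView v (punchIn v i)

punchInView : (v x : Fin (suc n)) → PunchInView v x
punchInView v x with v ≟ x
... | yes refl = pivot
... | no v≢x   = subst (PunchInView v) (punchIn-punchOut v≢x) (punched (punchOut v≢x))

v∈insertAt-inside : (p : Subset n) (v : Fin (suc n)) → v ∈ insertAt p v inside
v∈insertAt-inside p v = lookup⇒[]= v _ (insertAt-lookup p v inside)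

punchIn∈insertAt⁺ : {p : Subset n} (v : Fin (suc n)) {s : Bool} {i : Fin n} →
  i ∈ p → punchIn v i ∈ insertAt p v s
punchIn∈insertAt⁺ {p = p} v {s} {i} i∈p =
  lookup⇒[]= _ _ (trans (insertAt-punchIn p v s i) ([]=⇒lookup i∈p))

punchIn∈insertAt⁻ : {p : Subset n} (v : Fin (suc n)) {s : Bool} {i : Fin n} →
  punchIn v i ∈ insertAt p v s → i ∈ p
punchIn∈insertAt⁻ {p = p} v {s} {i} i∈ =
  lookup⇒[]= i p (trans (sym (insertAt-punchIn p v s i)) ([]=⇒lookup i∈))

insertAt-inside⊆ : {p : Subset n} {q : Subset (suc n)} (v : Fin (suc n)) →
  v ∈ q → (∀ {i} → i ∈ p → punchIn v i ∈ q) → insertAt p v inside ⊆ q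
insertAt-inside⊆ v v∈q lift {x} x∈ with punchInView v x
... | pivot     = v∈q
... | punched i = lift (punchIn∈insertAt⁻ v x∈)

⊆insertAt-outside : {p : Subset (suc n)} {q : Subset n} (v : Fin (suc n)) →
  v ∉ p → (∀ {i} → punchIn v i ∈ p → i ∈ q) → p ⊆ insertAt q v outside
⊆insertAt-outside v v∉p lower {x} x∈p with punchInView v x
... | pivot     = ⊥-elim (v∉p x∈p)
... | punched i = punchIn∈insertAt⁺ v (lower x∈p)

Full-insertAt-inside : {p : Subset n} (v : Fin (suc n)) → Full p → Full (insertAt p v inside)
Full-insertAt-inside v full x with punchInView v x
... | pivot     = v∈insertAt-inside _ v
... | punched i = punchIn∈insertAt⁺ v (full i)

Full? : (p : Subset n) → Dec (Full p)
Full? p = all? (_∈? p)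

∈N[]⁻ : (G : Graph n) {u w : Fin n} → w ∈ N[ G ] u → w ≡ u ⊎ T (adj G u w)
∈N[]⁻ G {u} {w} w∈ =
  Sum.map toWitness id (Equivalence.to T-∨ (subst T (lookup∘tabulate _ w) (∈⇒T-lookup w∈)))

∈N[]⁺ : (G : Graph n) {u w : Fin n} → w ≡ u ⊎ T (adj G u w) → w ∈ N[ G ] u
∈N[]⁺ G {u} {w} h =
  T-lookup⇒∈ (subst T (sym (lookup∘tabulate _ w)) (Equivalence.from T-∨ (Sum.map fromWitness id h)))

u∈N[u] : (G : Graph n) (u : Fin n) → u ∈ N[ G ] u
u∈N[u] G u = ∈N[]⁺ G (inj₁ refl)

punchIn∈N[punchIn]⁺ : (G : Graph (suc n)) (v : Fin (suc n)) {u i : Fin n} →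
  i ∈ N[ delete G v ] u → punchIn v i ∈ N[ G ] (punchIn v u)
punchIn∈N[punchIn]⁺ G v i∈ = ∈N[]⁺ G (Sum.map (cong (punchIn v)) id (∈N[]⁻ (delete G v) i∈))

punchIn∈N[punchIn]⁻ : (G : Graph (suc n)) (v : Fin (suc n)) {u i : Fin n} →
  punchIn v i ∈ N[ G ] (punchIn v u) → i ∈ N[ delete G v ] u
punchIn∈N[punchIn]⁻ G v {u} {i} i∈ =
  ∈N[]⁺ (delete G v) (Sum.map (punchIn-injective v i u) id (∈N[]⁻ G i∈))

∈NS[]⁻ : (G : Graph n) {S : Subset n} {w : Fin n} → w ∈ NS[ G ] S → ∃[ u ] (u ∈ S × w ∈ N[ G ] u)
∈NS[]⁻ G {S} w∈ =
  let (u , u∈S , w∈N) = ∈⋃-when⁻ (lookup S) (N[ G ]_) w∈ in u , T-lookup⇒∈ u∈S , w∈N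

∈NS[]⁺ : (G : Graph n) {S : Subset n} {u w : Fin n} → u ∈ S → w ∈ N[ G ] u → w ∈ NS[ G ] S
∈NS[]⁺ G {S} u∈S = ∈⋃-when⁺ (lookup S) (N[ G ]_) (∈⇒T-lookup u∈S)

Forces : ℕ → Graph n → Subset n → Fin n → Set
Forces k G X u = u ∈ X × ∣ N[ G ] u ─ X ∣ ≤ k

∈step⁻ : (G : Graph n) {X : Subset n} {w : Fin n} →
  w ∈ step k G X → ∃[ u ] (Forces k G X u × w ∈ N[ G ] u)
∈step⁻ G w∈ =
  let (u , fires , w∈N) = ∈⋃-when⁻ _ (N[ G ]_) w∈
      (u∈X , few) = Equivalence.to T-∧ fires
  in u , (T-lookup⇒∈ u∈X , toWitness few) , w∈N

∈step⁺ : (G : Graph n) {X : Subset n} {u w : Fin n} →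
  Forces k G X u → w ∈ N[ G ] u → w ∈ step k G X
∈step⁺ G (u∈X , few) = ∈⋃-when⁺ _ (N[ G ]_) (Equivalence.from T-∧ (∈⇒T-lookup u∈X , fromWitness few))

IsNbhdUnion : Graph n → Subset n → Set
IsNbhdUnion G X = ∀ {x} → x ∈ X → ∃[ u ] (N[ G ] u ⊆ X × x ∈ N[ G ] u)

NS-isNbhdUnion : (G : Graph n) (S : Subset n) → IsNbhdUnion G (NS[ G ] S)
NS-isNbhdUnion G S x∈ = let (u , u∈S , x∈N) = ∈NS[]⁻ G x∈ in u , ∈NS[]⁺ G {S = S} u∈S , x∈N

step-isNbhdUnion : (G : Graph n) (X : Subset n) → IsNbhdUnion G (step k G X)
step-isNbhdUnion G X x∈ = let (u , forces , x∈N) = ∈step⁻ G x∈ in u , ∈step⁺ G forces , x∈N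

-- A vertex whose closed neighbourhood is already observed passes the threshold for every k.
isNbhdUnion⇒⊆step : (G : Graph n) {X : Subset n} → IsNbhdUnion G X → X ⊆ step k G X
isNbhdUnion⇒⊆step G isUnion x∈ =
  let (u , N⊆X , x∈N) = isUnion x∈
  in ∈step⁺ G (N⊆X (u∈N[u] G u) , ≤-trans (≤-reflexive (p⊆q⇒∣p─q∣≡0 N⊆X)) z≤n) x∈N

P⊆P-suc : (G : Graph n) (S : Subset n) (t : ℕ) → P k G t S ⊆ P k G (suc t) S
P⊆P-suc G S zero    = isNbhdUnion⇒⊆step G (NS-isNbhdUnion G S)
P⊆P-suc G S (suc t) = isNbhdUnion⇒⊆step G (step-isNbhdUnion G _)

P⇒Nonempty : (G : Graph n) (S : Subset n) (t : ℕ) {x : Fin n} → x ∈ P k G t S → Nonempty S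
P⇒Nonempty G S zero    x∈ = let (u , u∈S , _) = ∈NS[]⁻ G x∈ in u , u∈S
P⇒Nonempty G S (suc t) x∈ = let (u , (u∈X , _) , _) = ∈step⁻ G x∈ in P⇒Nonempty G S t u∈X

PDS⇒1≤∣S∣ : (G : Graph (suc n)) {S : Subset (suc n)} → IsPDS k G S → 1 ≤ ∣ S ∣
PDS⇒1≤∣S∣ G {S} pds = let (t , 0∈P) = pds zero in Nonempty⇒1≤∣p∣ (P⇒Nonempty G S t 0∈P)

Edgeless : Graph n → Set
Edgeless G = ∀ u w → ¬ T (adj G u w)

edgeless⇒P⊆S : (G : Graph n) → Edgeless G → (S : Subset n) (t : ℕ) → P k G t S ⊆ S
edgeless⇒P⊆S G noEdge S zero x∈ =
  let (u , u∈S , x∈N) = ∈NS[]⁻ G x∈ in subst (_∈ S) (sym (N[u]≡u x∈N)) u∈S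
  where
  N[u]≡u : ∀ {u x} → x ∈ N[ G ] u → x ≡ u
  N[u]≡u x∈N = [ id , ⊥-elim ∘ noEdge _ _ ]′ (∈N[]⁻ G x∈N)
edgeless⇒P⊆S G noEdge S (suc t) x∈ with ∈step⁻ G x∈
... | u , (u∈X , _) , x∈N with ∈N[]⁻ G x∈N
...   | inj₁ refl = edgeless⇒P⊆S G noEdge S t u∈X
...   | inj₂ edge = ⊥-elim (noEdge u _ edge)

γ-edgeless : (G : Graph n) → Edgeless G → IsGammaP k G n
γ-edgeless {n} G noEdge =
  (⊤ , (λ w → 0 , ∈NS[]⁺ G {S = ⊤} ∈⊤ (u∈N[u] G w)) , ∣⊤∣≡n n) ,
  λ S pds → subst (_≤ ∣ S ∣) (∣⊤∣≡n n) (p⊆q⇒∣p∣≤∣q∣ {p = ⊤} λ {x} _ →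
              let (t , x∈P) = pds x in edgeless⇒P⊆S G noEdge S t x∈P)

star : ∀ m → Graph (suc m)
star m = record { adj = star-adj ; adj-sym = star-sym ; adj-irrefl = star-irrefl }
  where
  star-adj : Fin (suc m) → Fin (suc m) → Bool
  star-adj zero    zero    = false
  star-adj zero    (suc _) = true
  star-adj (suc _) zero    = true
  star-adj (suc _) (suc _) = false
  star-sym : ∀ u w → star-adj u w ≡ star-adj w u
  star-sym zero    zero    = refl
  star-sym zero    (suc _) = refl
  star-sym (suc _) zero    = refl
  star-sym (suc _) (suc _) = refl
  star-irrefl : ∀ u → star-adj u u ≡ false
  star-irrefl zero    = refl
  star-irrefl (suc _) = refl

N[centre]-full : ∀ m → Full (N[ star m ] zero)
N[centre]-full m zero    = u∈N[u] (star m) zero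
N[centre]-full m (suc w) = ∈N[]⁺ (star m) {u = zero} (inj₂ _)

γ-star : ∀ m → IsGammaP k (star m) 1
γ-star m =
  (⁅ zero ⁆ , centre-dominates , ∣⁅x⁆∣≡1 {n = suc m} zero) , λ S → PDS⇒1≤∣S∣ (star m)
  where
  centre-dominates : IsPDS k (star m) ⁅ zero ⁆
  centre-dominates w = 0 , ∈NS[]⁺ (star m) {S = ⁅ zero ⁆} (x∈⁅x⁆ zero) (N[centre]-full m w)

module _ (G : Graph (suc n)) (v : Fin (suc n)) where

  forces-punchIn : {X : Subset n} {Y : Subset (suc n)} {u : Fin n} →
    insertAt X v inside ⊆ Y → Forces k (delete G v) X u → Forces k G Y (punchIn v u)
  forces-punchIn {X = X} {Y} {u} X⊆Y (u∈X , few) =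
    X⊆Y (punchIn∈insertAt⁺ v u∈X) , ≤-trans fewer few
    where
    NG : Subset (suc n)
    NG = N[ G ] (punchIn v u)
    NH : Subset n
    NH = N[ delete G v ] u
    v∉ : v ∉ NG ─ Y
    v∉ v∈ = x∈p─q⇒x∉q NG Y v∈ (X⊆Y (v∈insertAt-inside X v))
    lower : ∀ {i} → punchIn v i ∈ NG ─ Y → i ∈ NH ─ X
    lower i∈ = x∈p∧x∉q⇒x∈p─q (punchIn∈N[punchIn]⁻ G v (p─q⊆p NG Y i∈))
                 (λ i∈X → x∈p─q⇒x∉q NG Y i∈ (X⊆Y (punchIn∈insertAt⁺ v i∈X)))
    fewer : ∣ NG ─ Y ∣ ≤ ∣ NH ─ X ∣
    fewer = subst (_ ≤_) (∣insertAt∣≡∣∷∣ _ v) (p⊆q⇒∣p∣≤∣q∣ (⊆insertAt-outside v v∉ lower))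

  insertAt-P⊆P-insertAt : (S : Subset n) (t : ℕ) →
    insertAt (P k (delete G v) t S) v inside ⊆ P k G t (insertAt S v inside)
  insertAt-P⊆P-insertAt S zero =
    insertAt-inside⊆ v (∈NS[]⁺ G (v∈insertAt-inside S v) (u∈N[u] G v)) λ i∈ →
      let (u , u∈S , i∈N) = ∈NS[]⁻ (delete G v) i∈
      in ∈NS[]⁺ G (punchIn∈insertAt⁺ v u∈S) (punchIn∈N[punchIn]⁺ G v i∈N)
  insertAt-P⊆P-insertAt {k = k} S (suc t) =
    insertAt-inside⊆ v (P⊆P-suc G _ t (IH (v∈insertAt-inside _ v))) λ i∈ →
      let (u , forces , i∈N) = ∈step⁻ (delete G v) i∈
      in ∈step⁺ G (forces-punchIn IH forces) (punchIn∈N[punchIn]⁺ G v i∈N)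
    where
    IH : insertAt (P k (delete G v) t S) v inside ⊆ P k G t (insertAt S v inside)
    IH = insertAt-P⊆P-insertAt S t

  PDS-insertAt : {S : Subset n} → IsPDS k (delete G v) S → IsPDS k G (insertAt S v inside)
  PDS-insertAt {k = k} {S = S} pds x with punchInView v x
  ... | pivot     = 0 , insertAt-P⊆P-insertAt {k = k} S 0 (v∈insertAt-inside _ v)
  ... | punched i = let (t , i∈P) = pds i in t , insertAt-P⊆P-insertAt S t (punchIn∈insertAt⁺ v i∈P)

  Full-P-insertAt : (S : Subset n) (t : ℕ) →
    Full (P k (delete G v) t S) → Full (P k G t (insertAt S v inside))
  Full-P-insertAt S t full x = insertAt-P⊆P-insertAt S t (Full-insertAt-inside v full x)

module _ {Q : ℕ → Set} (Q? : Decidable Q) where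

  least-≤ : ∀ t → ∃[ s ] (Q s × (∀ s′ → Q s′ → s ≤ s′) × s ≤ t) ⊎ (∀ s → s ≤ t → ¬ Q s)
  least-≤ zero with Q? zero
  ... | yes q0 = inj₁ (zero , q0 , (λ _ _ → z≤n) , z≤n)
  ... | no ¬q0 = inj₂ λ { zero z≤n → ¬q0 }
  least-≤ (suc t) with least-≤ t
  ... | inj₁ (s , qs , minimal , s≤t) = inj₁ (s , qs , minimal , m≤n⇒m≤1+n s≤t)
  ... | inj₂ none with Q? (suc t)
  ...   | yes q = inj₁ (suc t , q , (λ s′ qs′ → ≰⇒> λ s′≤t → none s′ s′≤t qs′) , ≤-refl)
  ...   | no ¬q = inj₂ λ s s≤1+t →
            [ (λ s<1+t → none s (≤-pred s<1+t)) , (λ { refl → ¬q }) ]′ (m≤n⇒m<n∨m≡n s≤1+t)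

  least : ∀ t → Q t → ∃[ s ] (Q s × (∀ s′ → Q s′ → s ≤ s′) × s ≤ t)
  least t qt = [ id , (λ none → ⊥-elim (none t ≤-refl qt)) ]′ (least-≤ t)

radPS≤ : (G : Graph n) (S : Subset n) (t : ℕ) →
  Full (P k G t S) → ∃[ r ] (IsRadPS k G S r × r ≤ suc t)
radPS≤ {k = k} G S t full =
  let (s , full-s , minimal , s≤t) = least (λ t → Full? (P k G t S)) t full
  in suc s , (s , refl , full-s , minimal) , s≤s s≤t

γ-delete-unbounded : ¬ (Σ[ f ∈ (ℕ → ℕ) ] (∀ {n} (G : Graph (suc n)) (v : Fin (suc n)) (a b : ℕ) →
  IsGammaP k G a → IsGammaP k (delete G v) b → b ≤ f a))
γ-delete-unbounded (f , bound) =
  1+n≰n (bound (star (suc (f 1))) zero 1 (suc (f 1)) (γ-star _) (γ-edgeless _ λ _ _ ()))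

γ≤1+γ-delete : (G : Graph (suc n)) (v : Fin (suc n)) {a b : ℕ} →
  IsGammaP k G a → IsGammaP k (delete G v) b → a ≤ suc b
γ≤1+γ-delete G v (_ , minimal) ((S , pds , refl) , _) =
  subst (_ ≤_) (∣insertAt∣≡∣∷∣ S v) (minimal _ (PDS-insertAt G v pds))

rad≤rad-delete : (G : Graph (suc n)) (v : Fin (suc n)) {a b r r′ : ℕ} → a ≡ suc b →
  IsRadP k G a r → IsRadP k (delete G v) b r′ → r ≤ r′
rad≤rad-delete {k = k} G v a≡1+b (_ , minimal) ((S , pds , refl , (t , refl , full , _)) , _) =
  let (r , radS⁺ , r≤) = radPS≤ G (insertAt S v inside) t (Full-P-insertAt G v S t full)
  in ≤-trans (minimal _ (PDS-insertAt G v pds) (trans (∣insertAt∣≡∣∷∣ S v) (sym a≡1+b)) r radS⁺) r≤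

theorem2 : (k : ℕ) → 1 ≤ k →
    (¬ (Σ[ f ∈ (ℕ → ℕ) ] (∀ {n} (G : Graph (suc n)) (v : Fin (suc n)) (a b : ℕ) →
          IsGammaP k G a → IsGammaP k (delete G v) b → b ≤ f a)))
    × (∀ {n} (G : Graph (suc n)) (v : Fin (suc n)) (a b : ℕ) →
          IsGammaP k G a → IsGammaP k (delete G v) b → a ≤ suc b)
    × (∀ {n} (G : Graph (suc n)) (v : Fin (suc n)) (a b : ℕ) →
          IsGammaP k G a → IsGammaP k (delete G v) b → a ≡ suc b →
          ∀ (r r' : ℕ) → IsRadP k G a r → IsRadP k (delete G v) b r' → r ≤ r')
theorem2 k _ =
  γ-delete-unbounded ,
  (λ G v a b γG γG-v → γ≤1+γ-delete G v γG γG-v) ,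
  (λ G v a b _ _ a≡1+b r r′ radG radG-v → rad≤rad-delete G v a≡1+b radG radG-v)
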